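{- The supported companion $\underline{\mathcal{M}}$ of the monotone neighborhood functor $\mathcal{M}$ preserves weak pullbacks.
   Context: The monotone neighborhood functor: $\mathcal{M}X=\{N\subseteq\mathcal{P}X\mid Z\in N,\ Z\subseteq Z'\subseteq X\Rightarrow Z'\in N\}$, $\mathcal{M}f(N)=\{Z\subseteq Y\mid f^{ -1}(Z)\in N\}$ for $f:X\to Y$. $Z\subseteq X$ supports $\alpha\in\mathcal{M}X$ if $\alpha=\mathcal{M}\iota(\beta)$ for some $\beta\in\mathcal{M}Z$, $\iota:Z\to X$ the inclusion. The supported companion is the subfunctor $\underline{\mathcal{M}}$ of $\mathcal{P}\times\mathcal{M}$ with $\underline{\mathcal{M}}X=\{(Z,\alpha)\mid\alpha\in\mathcal{M}X,\ Z\text{ supports }\alpha\}$ and $\underline{\mathcal{M}}f(Z,\alpha)=(f[Z],\mathcal{M}f(\alpha))$. A set functor $\mathsf{F}$ preserves weak pullbacks if for all $f_1:X_1\to Y$, $f_2:X_2\to Y$ and $\alpha_i\in\mathsf{F}X_i$ with $\mathsf{F}f_1(\alpha_1)=\mathsf{F}f_2(\alpha_2)$ there is $\gamma\in\mathsf{F}R$, where $R=\{(u,v)\in X_1\times X_2\mid f_1(u)=f_2(v)\}$ with projections $\pi_1,\pi_2$, such that $\mathsf{F}\pi_i(\gamma)=\alpha_i$ for $i=1,2$. -}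

module Defs where

open import Data.Product using (Σ; Σ-syntax; _×_; _,_; proj₁; proj₂)
open import Relation.Binary.PropositionalEquality using (_≡_; refl)

Subset : Set → Set₁
Subset X = X → Set

_⊆_ : {X : Set} → Subset X → Subset X → Set
Z ⊆ Z' = ∀ x → Z x → Z' x

_≐_ : {X : Set} → Subset X → Subset X → Set
Z ≐ Z' = (Z ⊆ Z') × (Z' ⊆ Z)

_⁻¹[_] : {X Y : Set} → (X → Y) → Subset Y → Subset X
f ⁻¹[ Z ] = λ x → Z (f x)

_[_] : {X Y : Set} → (X → Y) → Subset X → Subset Y
f [ Z ] = λ y → Σ _ λ x → Z x × f x ≡ y

UpClosed : {X : Set} → (Subset X → Set) → Set₁
UpClosed {X} N = ∀ (Z Z' : Subset X) → N Z → Z ⊆ Z' → N Z'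

M : Set → Set₁
M X = Σ (Subset X → Set) UpClosed

Mmap : {X Y : Set} → (X → Y) → M X → M Y
Mmap f (N , up) = (λ Z → N (f ⁻¹[ Z ])) , (λ Z Z' n Z⊆Z' → up _ _ n (λ x → Z⊆Z' (f x)))

_≈M_ : {X : Set} → M X → M X → Set₁
_≈M_ {X} (N , _) (N' , _) = ∀ (U : Subset X) → (N U → N' U) × (N' U → N U)

-- Z supports α : α = M ι (β) for some β ∈ M Z, ι : Z → X the inclusion
Supports : {X : Set} → Subset X → M X → Set₁
Supports {X} Z α = Σ (M (Σ X Z)) λ β → Mmap proj₁ β ≈M α

-- The supported companion (subfunctor of P × M)
SM : Set → Set₁
SM X = Σ (Subset X) λ Z → Σ (M X) λ α → Supports Z α

private
  corestrict : {X Y : Set} (f : X → Y) (Z : Subset X) → Σ X Z → Σ Y (f [ Z ])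
  corestrict f Z (x , z) = f x , (x , z , refl)

SMmap : {X Y : Set} → (X → Y) → SM X → SM Y
SMmap f (Z , α , β , s) =
  f [ Z ] , Mmap f α , Mmap (corestrict f Z) β , (λ U → s (f ⁻¹[ U ]))

-- equality in SM X is that of P X × M X (extensional)
_≈S_ : {X : Set} → SM X → SM X → Set₁
(Z , α , _) ≈S (Z' , α' , _) = (Z ≐ Z') × (α ≈M α')

Pb : {X₁ X₂ Y : Set} → (X₁ → Y) → (X₂ → Y) → Set
Pb {X₁} {X₂} f₁ f₂ = Σ (X₁ × X₂) λ p → f₁ (proj₁ p) ≡ f₂ (proj₂ p)

π₁ : {X₁ X₂ Y : Set} {f₁ : X₁ → Y} {f₂ : X₂ → Y} → Pb f₁ f₂ → X₁
π₁ ((u , _) , _) = u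

π₂ : {X₁ X₂ Y : Set} {f₁ : X₁ → Y} {f₂ : X₂ → Y} → Pb f₁ f₂ → X₂
π₂ ((_ , v) , _) = v

SMPreservesWeakPullbacks : Set₁
SMPreservesWeakPullbacks =
  ∀ {X₁ X₂ Y : Set} (f₁ : X₁ → Y) (f₂ : X₂ → Y) (α₁ : SM X₁) (α₂ : SM X₂) →
  SMmap f₁ α₁ ≈S SMmap f₂ α₂ →
  Σ (SM (Pb f₁ f₂)) λ γ →
    (SMmap (π₁ {f₁ = f₁} {f₂ = f₂}) γ ≈S α₁) × (SMmap (π₂ {f₁ = f₁} {f₂ = f₂}) γ ≈S α₂)

module Submission where

-- Let (Zᵢ, αᵢ) be supported by βᵢ ∈ M(Σ Xᵢ Zᵢ) and write
-- gᵢ = fᵢ ∘ proj₁ : Σ Xᵢ Zᵢ → Y.  The hypotheses say that g₁ and g₂ have the same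
-- image and that M g₁ β₁ = M g₂ β₂.  On the pullback P of g₁ and g₂, with legs
-- q₁, q₂, put  δ = q₁* β₁ ∪ q₂* β₂,  where q* β = { U | {a | q⁻¹(a) ⊆ U} ∈ β }.
-- Since the images agree, both legs are surjective, so M qᵢ (qᵢ* βᵢ) = βᵢ; and the
-- "cross" term M q₁ (q₂* β₂) is contained in β₁ because M g₁ β₁ = M g₂ β₂.  Hence
-- M qᵢ δ = βᵢ: this is a weak-pullback property of M itself, valid for cospans whose
-- legs have equal images (the condition a support provides).
--
-- The
-- witness is γ = (W, M proj₁ δ), trivially supported by δ.

open import Defs
open import Function using (_∘_)
open import Data.Product using (Σ; _×_; _,_; proj₁; proj₂)
open import Data.Sum using (_⊎_; inj₁; inj₂; [_,_])
open import Relation.Binary.PropositionalEquality using (_≡_; refl; sym; trans; cong; subst)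

-- Inclusion of neighbourhood systems.  It is a record so that both systems can be
-- recovered from its type; ≈M is inclusion in both directions.
record _⊑_ {X : Set} (α α' : M X) : Set₁ where
  constructor ⊑-intro
  field ⊑-elim : ∀ (U : Subset X) → proj₁ α U → proj₁ α' U
open _⊑_

⊑-trans : {X : Set} {α α' α'' : M X} → α ⊑ α' → α' ⊑ α'' → α ⊑ α''
⊑-trans le le' = ⊑-intro λ U n → ⊑-elim le' U (⊑-elim le U n)

-- Equivalence of neighbourhood systems as a record (again so that its indices can be
-- inferred); it coincides with ≈M.
record _≅_ {X : Set} (α α' : M X) : Set₁ where
  constructor ≅-intro
  field
    ≅⇒⊑ : α ⊑ α'
    ≅⇒⊒ : α' ⊑ α
open _≅_

≈M-refl : {X : Set} (α : M X) → α ≈M α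
≈M-refl α U = (λ n → n) , (λ n → n)

≅⇒≈ : {X : Set} {α α' : M X} → α ≅ α' → α ≈M α'
≅⇒≈ e U = ⊑-elim (≅⇒⊑ e) U , ⊑-elim (≅⇒⊒ e) U

≈⇒≅ : {X : Set} {α α' : M X} → α ≈M α' → α ≅ α'
≈⇒≅ e = ≅-intro (⊑-intro λ U → proj₁ (e U)) (⊑-intro λ U → proj₂ (e U))

≅-sym : {X : Set} {α α' : M X} → α ≅ α' → α' ≅ α
≅-sym e = ≅-intro (≅⇒⊒ e) (≅⇒⊑ e)

≅-trans : {X : Set} {α α' α'' : M X} → α ≅ α' → α' ≅ α'' → α ≅ α''
≅-trans e e' = ≅-intro (⊑-trans (≅⇒⊑ e) (≅⇒⊑ e')) (⊑-trans (≅⇒⊒ e') (≅⇒⊒ e))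

Mmap-mono : {X Y : Set} (f : X → Y) {α α' : M X} → α ⊑ α' → Mmap f α ⊑ Mmap f α'
Mmap-mono f le = ⊑-intro λ U → ⊑-elim le (f ⁻¹[ U ])

Mmap-cong : {X Y : Set} (f : X → Y) {α α' : M X} → α ≅ α' → Mmap f α ≅ Mmap f α'
Mmap-cong f e = ≅-intro (Mmap-mono f (≅⇒⊑ e)) (Mmap-mono f (≅⇒⊒ e))

_∪M_ : {X : Set} → M X → M X → M X
α ∪M α' = (λ U → proj₁ α U ⊎ proj₁ α' U) , up
  where
  up : UpClosed (λ U → proj₁ α U ⊎ proj₁ α' U)
  up U U' (inj₁ n) U⊆U' = inj₁ (proj₂ α U U' n U⊆U')
  up U U' (inj₂ n) U⊆U' = inj₂ (proj₂ α' U U' n U⊆U')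

∪-least : {X : Set} {α α' β : M X} → α ⊑ β → α' ⊑ β → (α ∪M α') ⊑ β
∪-least le le' = ⊑-intro λ U → [ ⊑-elim le U , ⊑-elim le' U ]

∪-left : {X : Set} {α α' : M X} → α ⊑ (α ∪M α')
∪-left = ⊑-intro λ U → inj₁

∪-right : {X : Set} {α α' : M X} → α' ⊑ (α ∪M α')
∪-right = ⊑-intro λ U → inj₂

∪-comm : {X : Set} (α α' : M X) → (α ∪M α') ≅ (α' ∪M α)
∪-comm α α' = ≅-intro (∪-least ∪-right ∪-left) (∪-least ∪-right ∪-left)

Mmap-∪ : {X Y : Set} (f : X → Y) (α α' : M X) → Mmap f (α ∪M α') ≅ (Mmap f α ∪M Mmap f α')
Mmap-∪ f α α' = ≅-intro (⊑-intro λ U n → n) (⊑-intro λ U n → n)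

FibreIn : {P A : Set} → (P → A) → Subset P → Subset A
FibreIn p U a = ∀ w → p w ≡ a → U w

Mpull : {P A : Set} → (P → A) → M A → M P
Mpull p β = (λ U → proj₁ β (FibreIn p U))
          , (λ U U' n U⊆U' → proj₂ β _ _ n (λ a h w e → U⊆U' w (h w e)))

Onto : {P A : Set} → (P → A) → Set
Onto {P} {A} p = ∀ (a : A) → Σ P λ w → p w ≡ a

push-pull-⊒ : {P A : Set} (p : P → A) (β : M A) → β ⊑ Mmap p (Mpull p β)
push-pull-⊒ p β = ⊑-intro λ U n → proj₂ β U _ n (λ a u w e → subst U (sym e) u)

push-pull-⊑ : {P A : Set} {p : P → A} (β : M A) → Onto p → Mmap p (Mpull p β) ⊑ β
push-pull-⊑ {p = p} β onto = ⊑-intro λ U n → proj₂ β _ U n (fibre⊆ U)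
  where
  fibre⊆ : (U : Subset _) → FibreIn p (p ⁻¹[ U ]) ⊆ U
  fibre⊆ U a h with onto a
  ... | w , e = subst U e (h w e)

onto-image : {R X : Set} {W : Subset R} {Z : Subset X} (π : R → X) (q : Σ R W → Σ X Z) →
             (∀ w → proj₁ (q w) ≡ π (proj₁ w)) → Onto q → (π [ W ]) ≐ Z
onto-image {Z = Z} π q over onto = image⊆Z , Z⊆image
  where
  image⊆Z : (π [ _ ]) ⊆ Z
  image⊆Z x (r , wr , e) = subst Z (trans (over (r , wr)) e) (proj₂ (q (r , wr)))
  Z⊆image : Z ⊆ (π [ _ ])
  Z⊆image x z with onto (x , z)
  ... | w , e = proj₁ w , proj₂ w , trans (sym (over w)) (cong proj₁ e)

Fills : {A₁ A₂ Y P : Set} → (A₁ → Y) → (A₂ → Y) → (P → A₁) → (P → A₂) → Set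
Fills {A₁} {A₂} {Y} {P} g₁ g₂ q₁ q₂ =
  ∀ (a : A₁) (b : A₂) → g₁ a ≡ g₂ b → Σ P λ w → (q₁ w ≡ a) × (q₂ w ≡ b)

fills-swap : {A₁ A₂ Y P : Set} {g₁ : A₁ → Y} {g₂ : A₂ → Y} {q₁ : P → A₁} {q₂ : P → A₂} →
             Fills g₁ g₂ q₁ q₂ → Fills g₂ g₁ q₂ q₁
fills-swap fill b a e with fill a b (sym e)
... | w , e₁ , e₂ = w , e₂ , e₁

Covers : {A₁ A₂ Y : Set} → (A₁ → Y) → (A₂ → Y) → Set
Covers {A₁} {A₂} g₁ g₂ = ∀ (a : A₁) → Σ A₂ λ b → g₁ a ≡ g₂ b

fills-onto : {A₁ A₂ Y P : Set} {g₁ : A₁ → Y} {g₂ : A₂ → Y} {q₁ : P → A₁} {q₂ : P → A₂} →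
             Fills g₁ g₂ q₁ q₂ → Covers g₁ g₂ → Onto q₁
fills-onto fill cover a with cover a
... | b , e with fill a b e
...   | w , e₁ , _ = w , e₁

-- If the fibre
-- over b lies in q₁⁻¹ U, then every a matching b lies in U; the set C of y all of
-- whose g₁-preimages lie in U is thus a g₂-neighbourhood, hence a g₁-neighbourhood.
cross : {A₁ A₂ Y P : Set} {g₁ : A₁ → Y} {g₂ : A₂ → Y} {q₁ : P → A₁} {q₂ : P → A₂}
        (β₁ : M A₁) (β₂ : M A₂) → Fills g₁ g₂ q₁ q₂ →
        Mmap g₂ β₂ ⊑ Mmap g₁ β₁ → Mmap q₁ (Mpull q₂ β₂) ⊑ β₁
cross {A₁} {Y = Y} {g₁ = g₁} {g₂} {q₁} {q₂} β₁ β₂ fill le = ⊑-intro λ U n →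
  proj₂ β₁ _ U (⊑-elim le (C U) (proj₂ β₂ _ _ n (fibre⊆C U))) (λ a h → h a refl)
  where
  C : Subset A₁ → Subset Y
  C U y = ∀ (a : A₁) → g₁ a ≡ y → U a
  fibre⊆C : (U : Subset A₁) → FibreIn q₂ (q₁ ⁻¹[ U ]) ⊆ (g₂ ⁻¹[ C U ])
  fibre⊆C U b h a e with fill a b e
  ... | w , e₁ , e₂ = subst U e₁ (h w e₂)

amalgam-leg : {A₁ A₂ Y P : Set} {g₁ : A₁ → Y} {g₂ : A₂ → Y} {q₁ : P → A₁} {q₂ : P → A₂}
              (β₁ : M A₁) (β₂ : M A₂) → Fills g₁ g₂ q₁ q₂ → Covers g₁ g₂ →
              Mmap g₂ β₂ ⊑ Mmap g₁ β₁ → Mmap q₁ (Mpull q₁ β₁ ∪M Mpull q₂ β₂) ≅ β₁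
amalgam-leg {q₁ = q₁} {q₂} β₁ β₂ fill cover le =
  ≅-intro (⊑-trans (≅⇒⊑ (Mmap-∪ q₁ (Mpull q₁ β₁) (Mpull q₂ β₂)))
                   (∪-least (push-pull-⊑ β₁ (fills-onto fill cover)) (cross β₁ β₂ fill le)))
          (⊑-trans (push-pull-⊒ q₁ β₁)
                   (⊑-trans ∪-left (≅⇒⊒ (Mmap-∪ q₁ (Mpull q₁ β₁) (Mpull q₂ β₂)))))

M-amalgamate : {A₁ A₂ Y P : Set} {g₁ : A₁ → Y} {g₂ : A₂ → Y} {q₁ : P → A₁} {q₂ : P → A₂}
               (β₁ : M A₁) (β₂ : M A₂) → Fills g₁ g₂ q₁ q₂ → Covers g₁ g₂ → Covers g₂ g₁ →
               Mmap g₁ β₁ ≅ Mmap g₂ β₂ →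
               Σ (M P) λ δ → (Mmap q₁ δ ≅ β₁) × (Mmap q₂ δ ≅ β₂)
M-amalgamate {q₁ = q₁} {q₂} β₁ β₂ fill cover₁ cover₂ agree =
  Mpull q₁ β₁ ∪M Mpull q₂ β₂
  , amalgam-leg β₁ β₂ fill cover₁ (≅⇒⊒ agree)
  , ≅-trans (Mmap-cong q₂ (∪-comm (Mpull q₁ β₁) (Mpull q₂ β₂)))
            (amalgam-leg β₂ β₁ (fills-swap fill) cover₂ (≅⇒⊑ agree))

image-covers : {X₁ X₂ Y : Set} {f₁ : X₁ → Y} {f₂ : X₂ → Y} {Z₁ : Subset X₁} {Z₂ : Subset X₂} →
               (f₁ [ Z₁ ]) ⊆ (f₂ [ Z₂ ]) → Covers (f₁ ∘ proj₁ {B = Z₁}) (f₂ ∘ proj₁ {B = Z₂})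
image-covers incl (u , z₁) with incl _ (u , z₁ , refl)
... | v , z₂ , e = (v , z₂) , sym e

module SupportPullback {X₁ X₂ Y : Set} (f₁ : X₁ → Y) (f₂ : X₂ → Y) (Z₁ : Subset X₁) (Z₂ : Subset X₂) where

  R : Set
  R = Pb f₁ f₂

  p₁ : R → X₁
  p₁ = π₁ {f₁ = f₁} {f₂ = f₂}

  p₂ : R → X₂
  p₂ = π₂ {f₁ = f₁} {f₂ = f₂}

  W : Subset R
  W r = Z₁ (p₁ r) × Z₂ (p₂ r)

  q₁ : Σ R W → Σ X₁ Z₁
  q₁ (r , z₁ , _) = p₁ r , z₁

  q₂ : Σ R W → Σ X₂ Z₂
  q₂ (r , _ , z₂) = p₂ r , z₂

  fill : Fills (f₁ ∘ proj₁) (f₂ ∘ proj₁) q₁ q₂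
  fill (u , z₁) (v , z₂) e = (((u , v) , e) , z₁ , z₂) , refl , refl

proposition6p3 : SMPreservesWeakPullbacks
proposition6p3 f₁ f₂ (Z₁ , α₁ , β₁ , s₁) (Z₂ , α₂ , β₂ , s₂) ((im₁⊆im₂ , im₂⊆im₁) , agree) =
  (W , Mmap proj₁ δ , δ , ≈M-refl (Mmap proj₁ δ))
  , (onto-image p₁ q₁ (λ _ → refl) (fills-onto fill cover₁)
    , ≅⇒≈ (≅-trans (Mmap-cong proj₁ (proj₁ (proj₂ amalgam))) support₁))
  , (onto-image p₂ q₂ (λ _ → refl) (fills-onto (fills-swap fill) cover₂)
    , ≅⇒≈ (≅-trans (Mmap-cong proj₁ (proj₂ (proj₂ amalgam))) support₂))
  where
  open SupportPullback f₁ f₂ Z₁ Z₂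
  cover₁ : Covers (f₁ ∘ proj₁) (f₂ ∘ proj₁)
  cover₁ = image-covers im₁⊆im₂
  cover₂ : Covers (f₂ ∘ proj₁) (f₁ ∘ proj₁)
  cover₂ = image-covers im₂⊆im₁
  support₁ : Mmap proj₁ β₁ ≅ α₁
  support₁ = ≈⇒≅ s₁
  support₂ : Mmap proj₁ β₂ ≅ α₂
  support₂ = ≈⇒≅ s₂
  β-agree : Mmap (f₁ ∘ proj₁) β₁ ≅ Mmap (f₂ ∘ proj₁) β₂
  β-agree = ≅-trans (Mmap-cong f₁ support₁) (≅-trans (≈⇒≅ agree) (≅-sym (Mmap-cong f₂ support₂)))
  amalgam : Σ (M (Σ R W)) λ δ → (Mmap q₁ δ ≅ β₁) × (Mmap q₂ δ ≅ β₂)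
  amalgam = M-amalgamate β₁ β₂ fill cover₁ cover₂ β-agree
  δ : M (Σ R W)
  δ = proj₁ amalgam
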